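{- Let $\mathsf{n}$ be a linearly dependent tuple of linear subspaces of a finite-dimensional vector space $V$ over a field $\mathbb{K}$. For each basis $\mathsf{b}$ of the Minkowski matroid $\mathsf{M}(\mathsf{n})$, let $\mathsf{k}_{\mathsf{b}}$ denote the unique inclusion-maximal BK-subtuple of $\mathsf{b}$. Then $\mathfrak{c}(\mathsf{k}_{\mathsf{b}})$ is the same for all bases $\mathsf{b}$.
   Context: A tuple is a finite indexed family of linear subspaces of $V$ (repetitions allowed); a subtuple is a subfamily indexed by a subset of the index set. For a tuple $\mathsf{k}$, $\langle\mathsf{k}\rangle=\sum_{L\in\mathsf{k}}L$ (zero for the empty tuple), $\mathfrak{c}(\mathsf{k})$ is the number of its entries, and $\delta(\mathsf{k})=\dim\langle\mathsf{k}\rangle-\mathfrak{c}(\mathsf{k})$ is its defect. A tuple is linearly independent if every subtuple (including itself) has non-negative defect, and linearly dependent otherwise. A BK-tuple is a linearly independent tuple with defect $0$. The Minkowski matroid $\mathsf{M}(\mathsf{n})$ has ground set the entries (indices) of $\mathsf{n}$ and independent sets the linearly independent subtuples; a basis is a maximal linearly independent subtuple. (Each basis contains a unique inclusion-maximal BK-subtuple.) -}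

module Defs where

open import Level using (Level; _⊔_) renaming (suc to lsuc)
open import Algebra.Bundles using (CommutativeRing)
open import Data.Nat using (ℕ; _≤_)
open import Data.Fin using (Fin; zero; suc)
open import Data.Fin.Subset using (Subset; _∈_; _⊆_; ∣_∣; ⊤)
open import Data.Fin.Subset.Properties using (_∈?_)
open import Data.List using (List; []; _∷_; length; concat; map; allFin)
open import Data.List.Relation.Binary.Sublist.Propositional as SL using ()
open import Data.Product using (Σ; _×_; _,_)
open import Relation.Nullary using (¬_; does)
open import Data.Bool using (if_then_else_)
open import Data.Integer using (ℤ; +_; _-_) renaming (_≤_ to _ℤ≤_)
open import Relation.Binary.PropositionalEquality using (_≡_)

record Field (c ℓ : Level) : Set (lsuc (c ⊔ ℓ)) where
  field
    commutativeRing : CommutativeRing c ℓ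
  open CommutativeRing commutativeRing public
  field
    0≉1     : ¬ (0# ≈ 1#)
    inverse : ∀ x → ¬ (x ≈ 0#) → Σ Carrier (λ y → (x * y) ≈ 1#)

module LinearAlgebra {c ℓ : Level} (K : Field c ℓ) (d : ℕ) where
  open Field K using (Carrier; _≈_; _+_; _*_; 0#)

  V : Set c
  V = Fin d → Carrier

  _≈ᵥ_ : V → V → Set ℓ
  u ≈ᵥ v = ∀ j → u j ≈ v j

  0ᵥ : V
  0ᵥ _ = 0#

  _+ᵥ_ : V → V → V
  (u +ᵥ v) j = u j + v j

  _·_ : Carrier → V → V
  (a · v) j = a * v j

  lincomb : (ws : List V) → (Fin (length ws) → Carrier) → V
  lincomb []       cs = 0ᵥ
  lincomb (w ∷ ws) cs = (cs zero · w) +ᵥ lincomb ws (λ i → cs (suc i))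

  Independent : List V → Set (c ⊔ ℓ)
  Independent ws = ∀ (cs : Fin (length ws) → Carrier) →
    lincomb ws cs ≈ᵥ 0ᵥ → ∀ i → cs i ≈ 0#

  Dim : List V → ℕ → Set (c ⊔ ℓ)
  Dim ws r =
    Σ (List V) (λ us → (us SL.⊆ ws) × Independent us × length us ≡ r)
    × (∀ us → us SL.⊆ ws → Independent us → length us ≤ r)

  -- Tuples of m linear subspaces of V; each subspace is given by a finite
  -- spanning list of vectors (every subspace of K^d is of this form).
  Tuple : ℕ → Set c
  Tuple m = Fin m → List V

  -- A spanning list for ⟨n|S⟩ = Σ_{i ∈ S} n_i, the sum of the subtuple indexed by S.
  gens : ∀ {m} → Tuple m → Subset m → List V
  gens {m} n S = concat (map (λ i → if does (i ∈? S) then n i else []) (allFin m))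

  -- Defect n S z : δ(n|S) = dim ⟨n|S⟩ − 𝔠(n|S) equals z.
  Defect : ∀ {m} → Tuple m → Subset m → ℤ → Set (c ⊔ ℓ)
  Defect n S z = Σ ℕ (λ r → Dim (gens n S) r × z ≡ (+ r) - (+ ∣ S ∣))

  LinIndep : ∀ {m} → Tuple m → Subset m → Set (c ⊔ ℓ)
  LinIndep n T = ∀ S → S ⊆ T → ∀ z → Defect n S z → + 0 ℤ≤ z

  LinDep : ∀ {m} → Tuple m → Set (c ⊔ ℓ)
  LinDep {m} n = ¬ LinIndep n ⊤

  BK : ∀ {m} → Tuple m → Subset m → Set (c ⊔ ℓ)
  BK n T = LinIndep n T × Defect n T (+ 0)

  Basis : ∀ {m} → Tuple m → Subset m → Set (c ⊔ ℓ)
  Basis n b = LinIndep n b × (∀ b' → b ⊆ b' → LinIndep n b' → b' ⊆ b)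

  MaxBK : ∀ {m} → Tuple m → Subset m → Subset m → Set (c ⊔ ℓ)
  MaxBK n b k = k ⊆ b × BK n k × (∀ k' → k ⊆ k' → k' ⊆ b → BK n k' → k' ⊆ k)

-- The rank f X = dim ⟨n|X⟩ is monotone and submodular, n|X is linearly independent iff
-- ∣ S ∣ ≤ f S for all S ⊆ X, and a BK-tuple is such an X with f X = ∣ X ∣; so everything
-- happens in the matroid induced by f. Fix a basis b with maximal BK-subtuple k. If e ∉ b,
-- then b ∪ {e} contains a set S with f S < ∣ S ∣; its part S ∩ b is BK, hence inside k, and
-- submodularity yields f (k ∪ {e}) = f k. Thus f (k ∪ ∁ b) = ∣ k ∣, and splitting any
-- independent X along W = k ∪ ∁ b gives ∣ X ∣ ≤ ∣ X ∩ W ∣ + ∣ b ∖ k ∣ ≤ ∣ k ∣ + ∣ b ∖ k ∣ = ∣ b ∣.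
-- For another basis b′ all these inequalities are equalities, so b′ ∩ W is a BK-subtuple of b′
-- with at least ∣ k ∣ entries, whence ∣ k ∣ ≤ ∣ k′ ∣; the reverse follows by symmetry.
--
-- Equality in K is undecidable, so dimensions (computed by Gaussian elimination) exist only
-- under double negation; as the conclusion is a decidable equation in ℕ, that suffices.

{-# OPTIONS --safe #-}
module Submission where

open import Level using (Level; _⊔_)
open import Function using (_∘_; id)
import Data.Nat as Nat
open Nat using (ℕ; zero; suc; _≤_; _<_; z≤n; s≤s; _≤?_)
import Data.Nat.Properties as ℕₚ
open ℕₚ using (≤-trans; ≤-antisym; <⇒≱; ≮⇒≥; m<1+n⇒m≤n; module ≤-Reasoning)
open import Data.Vec using ([]; _∷_)
open import Data.Fin using (Fin; zero; suc; punchIn; punchOut)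
open import Data.Fin.Properties using (punchIn-punchOut; any?) renaming (_≟_ to _≟ᶠ_)
open import Data.Fin.Subset
  using (Subset; inside; outside; _∈_; _∉_; _⊆_; _∪_; _∩_; ∁; ⁅_⁆; ∣_∣; ⋃)
open import Data.Fin.Subset.Properties
  using (_∈?_; p⊆p∪q; q⊆p∪q; x∈p∪q⁺; x∈p∪q⁻; p∩q⊆p; p∩q⊆q; x∈p∩q⁺; x∈⁅x⁆; x∈⁅y⁆⇒x≡y;
         ∣⁅x⁆∣≡1; p⊆q⇒∣p∣≤∣q∣; x∈∁p⇒x∉p; x∉p⇒x∈∁p; ∪-assoc; ∉⊥)
open import Data.List using (List; []; _∷_; _++_; length; lookup; map; allFin)
open import Data.List.Properties using (length-++; ++-identityʳ)
import Data.List.Relation.Unary.All as All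
open import Data.List.Relation.Unary.All using (All; []; _∷_)
open import Data.List.Relation.Unary.All.Properties using (map⁺; ++⁺)
open import Data.List.Relation.Unary.Any using (here; there)
open import Data.List.Membership.Propositional using () renaming (_∈_ to _∈ₗ_)
open import Data.List.Membership.Propositional.Properties
  using (∈-map⁺; ∈-map⁻; ∈-allFin; ∈-lookup; ∈-concat⁺′; ∈-concat⁻′)
import Data.List.Relation.Binary.Sublist.Propositional as SL
open SL using ([]; _∷ʳ_; _∷_) renaming (_⊆_ to _⊑_)
import Data.List.Relation.Binary.Sublist.Propositional.Properties as SLₚ
open SLₚ using (All-resp-⊆)
open import Data.Product using (Σ; ∃; _×_; _,_; proj₁; proj₂)
import Data.Product as Product
open import Data.Sum using (_⊎_; inj₁; inj₂; [_,_]′)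
import Data.Sum as Sum
open import Data.Bool using (if_then_else_)
open import Data.Empty using (⊥-elim)
open import Relation.Nullary using (¬_; Dec; yes; no; does; contradiction; ¬?)
open import Relation.Nullary.Negation using (¬¬-map)
open import Relation.Nullary.Decidable using (decidable-stable; ¬¬-excluded-middle)
open import Relation.Binary.PropositionalEquality using (_≡_; refl; sym; trans; cong; cong₂; subst)
open import Defs

private
  variable
    a p : Level
    A B : Set a

  -- Unlike the library's ¬¬-Monad, this bind may change universe level.
  infixl 1 _>>=_

  _>>=_ : ¬ ¬ A → (A → ¬ ¬ B) → ¬ ¬ B
  (¬¬a >>= f) ¬b = ¬¬a λ x → f x ¬b

  pure : A → ¬ ¬ A
  pure x ¬x = ¬x x

¬¬-∀-Fin : ∀ {n} {P : Fin n → Set p} → (∀ i → ¬ ¬ P i) → ¬ ¬ (∀ i → P i)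
¬¬-∀-Fin {n = zero}  h = pure λ ()
¬¬-∀-Fin {n = suc n} h = do
  p₀ ← h zero
  ps ← ¬¬-∀-Fin (h ∘ suc)
  pure λ { zero → p₀ ; (suc i) → ps i }

¬¬-∀-Subset : ∀ {m} {P : Subset m → Set p} → (∀ X → ¬ ¬ P X) → ¬ ¬ (∀ X → P X)
¬¬-∀-Subset {m = zero}  h = do
  p[] ← h []
  pure λ { [] → p[] }
¬¬-∀-Subset {m = suc m} h = do
  ps ← ¬¬-∀-Subset (h ∘ (inside ∷_))
  qs ← ¬¬-∀-Subset (h ∘ (outside ∷_))
  pure λ { (inside ∷ X) → ps X ; (outside ∷ X) → qs X }

module _ where
  open Nat using (_+_)
  open ℕₚ using (+-suc; +-comm; +-assoc; +-mono-≤)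

  ∣p∪q∣+∣p∩q∣≡∣p∣+∣q∣ : ∀ {m} (X Y : Subset m) → ∣ X ∪ Y ∣ + ∣ X ∩ Y ∣ ≡ ∣ X ∣ + ∣ Y ∣
  ∣p∪q∣+∣p∩q∣≡∣p∣+∣q∣ []            []            = refl
  ∣p∪q∣+∣p∩q∣≡∣p∣+∣q∣ (inside ∷ X)  (inside ∷ Y)  =
    cong suc (trans (+-suc _ _) (trans (cong suc (∣p∪q∣+∣p∩q∣≡∣p∣+∣q∣ X Y)) (sym (+-suc _ _))))
  ∣p∪q∣+∣p∩q∣≡∣p∣+∣q∣ (inside ∷ X)  (outside ∷ Y) = cong suc (∣p∪q∣+∣p∩q∣≡∣p∣+∣q∣ X Y)
  ∣p∪q∣+∣p∩q∣≡∣p∣+∣q∣ (outside ∷ X) (inside ∷ Y)  =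
    trans (cong suc (∣p∪q∣+∣p∩q∣≡∣p∣+∣q∣ X Y)) (sym (+-suc _ _))
  ∣p∪q∣+∣p∩q∣≡∣p∣+∣q∣ (outside ∷ X) (outside ∷ Y) = ∣p∪q∣+∣p∩q∣≡∣p∣+∣q∣ X Y

  ∣p∣≡∣p∩q∣+∣p∩∁q∣ : ∀ {m} (X Y : Subset m) → ∣ X ∣ ≡ ∣ X ∩ Y ∣ + ∣ X ∩ ∁ Y ∣
  ∣p∣≡∣p∩q∣+∣p∩∁q∣ []            []            = refl
  ∣p∣≡∣p∩q∣+∣p∩∁q∣ (inside ∷ X)  (inside ∷ Y)  = cong suc (∣p∣≡∣p∩q∣+∣p∩∁q∣ X Y)
  ∣p∣≡∣p∩q∣+∣p∩∁q∣ (inside ∷ X)  (outside ∷ Y) = trans (cong suc (∣p∣≡∣p∩q∣+∣p∩∁q∣ X Y)) (sym (+-suc _ _))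
  ∣p∣≡∣p∩q∣+∣p∩∁q∣ (outside ∷ X) (inside ∷ Y)  = ∣p∣≡∣p∩q∣+∣p∩∁q∣ X Y
  ∣p∣≡∣p∩q∣+∣p∩∁q∣ (outside ∷ X) (outside ∷ Y) = ∣p∣≡∣p∩q∣+∣p∩∁q∣ X Y

  +-regroup-≤ : ∀ {u i e f j a b} → u ≤ e + f → i ≤ j → f ≤ a → e + j ≤ b → u + i ≤ a + b
  +-regroup-≤ {u} {i} {e} {f} {j} {a} {b} u≤e+f i≤j f≤a e+j≤b = begin
    u + i            ≤⟨ +-mono-≤ u≤e+f i≤j ⟩
    (e + f) + j      ≡⟨ cong (_+ j) (+-comm e f) ⟩
    (f + e) + j      ≡⟨ +-assoc f e j ⟩
    f + (e + j)      ≤⟨ +-mono-≤ f≤a e+j≤b ⟩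
    a + b            ∎
    where open ≤-Reasoning

module _ {m : ℕ} where

  ∪-least : ∀ {X Y Z : Subset m} → X ⊆ Z → Y ⊆ Z → X ∪ Y ⊆ Z
  ∪-least {X} {Y} X⊆Z Y⊆Z x∈X∪Y with x∈p∪q⁻ X Y x∈X∪Y
  ... | inj₁ x∈X = X⊆Z x∈X
  ... | inj₂ x∈Y = Y⊆Z x∈Y

  ∈-⋃ : ∀ {x} {X : Subset m} {Xs} → x ∈ X → X ∈ₗ Xs → x ∈ ⋃ Xs
  ∈-⋃ {Xs = Y ∷ Ys} x∈X (here refl)  = p⊆p∪q (⋃ Ys) x∈X
  ∈-⋃ {Xs = Y ∷ Ys} x∈X (there X∈Xs) = q⊆p∪q Y (⋃ Ys) (∈-⋃ x∈X X∈Xs)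

module InducedMatroid {m : ℕ} (f : Subset m → ℕ)
  (f-mono : ∀ {X Y} → X ⊆ Y → f X ≤ f Y)
  (f-submodular : ∀ X Y → f (X ∪ Y) Nat.+ f (X ∩ Y) ≤ f X Nat.+ f Y) where

  open Nat using (_+_)
  open ℕₚ using (+-comm; +-mono-≤; +-monoˡ-≤; +-monoʳ-≤; +-cancelʳ-≤; m≤m+n)
  open ≤-Reasoning

  Independent : Subset m → Set
  Independent X = ∀ S → S ⊆ X → ∣ S ∣ ≤ f S

  Tight : Subset m → Set
  Tight X = f X ≡ ∣ X ∣

  IsBK : Subset m → Set
  IsBK X = Independent X × Tight X

  record IsBasis (b : Subset m) : Set where
    field
      independent : Independent b
      maximal     : ∀ X → b ⊆ X → Independent X → X ⊆ b

  record IsMaxBKIn (b k : Subset m) : Set where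
    field
      core⊆     : k ⊆ b
      core-BK   : IsBK k
      core-max  : ∀ X → k ⊆ X → X ⊆ b → IsBK X → X ⊆ k

  -- In matroid language: X lies in the closure of A.
  Spans : Subset m → Subset m → Set
  Spans A X = f (A ∪ X) ≤ f A

  independent-⊆ : ∀ {X Y} → X ⊆ Y → Independent Y → Independent X
  independent-⊆ X⊆Y indY S S⊆X = indY S (X⊆Y ∘ S⊆X)

  tight-∪ : ∀ {X Y} → Independent (X ∪ Y) → Tight X → Tight Y → Tight (X ∪ Y)
  tight-∪ {X} {Y} ind tight-X tight-Y = ≤-antisym f[X∪Y]≤∣X∪Y∣ (ind (X ∪ Y) id)
    where
    f[X∪Y]≤∣X∪Y∣ : f (X ∪ Y) ≤ ∣ X ∪ Y ∣
    f[X∪Y]≤∣X∪Y∣ = +-cancelʳ-≤ (f (X ∩ Y)) _ _ (begin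
      f (X ∪ Y) + f (X ∩ Y)  ≤⟨ f-submodular X Y ⟩
      f X + f Y              ≡⟨ cong₂ _+_ tight-X tight-Y ⟩
      ∣ X ∣ + ∣ Y ∣          ≡⟨ sym (∣p∪q∣+∣p∩q∣≡∣p∣+∣q∣ X Y) ⟩
      ∣ X ∪ Y ∣ + ∣ X ∩ Y ∣  ≤⟨ +-monoʳ-≤ ∣ X ∪ Y ∣ (ind (X ∩ Y) (p⊆p∪q Y ∘ p∩q⊆p X Y)) ⟩
      ∣ X ∪ Y ∣ + f (X ∩ Y)  ∎)

  spans-⊆ : ∀ {A X Y} → Y ⊆ X → Spans A X → Spans A Y
  spans-⊆ {A} {X} Y⊆X A-spans-X = ≤-trans (f-mono (∪-least (p⊆p∪q X) (q⊆p∪q A X ∘ Y⊆X))) A-spans-X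

  spans-self : ∀ {A X} → X ⊆ A → Spans A X
  spans-self X⊆A = f-mono (∪-least id X⊆A)

  spans-mono : ∀ {A B X} → A ⊆ B → Spans A X → Spans B X
  spans-mono {A} {B} {X} A⊆B A-spans-X = +-cancelʳ-≤ (f A) _ _ (begin
    f (B ∪ X) + f A              ≤⟨ +-mono-≤ (f-mono B∪X⊆) (f-mono A⊆) ⟩
    f ((A ∪ X) ∪ B) + f ((A ∪ X) ∩ B)  ≤⟨ f-submodular (A ∪ X) B ⟩
    f (A ∪ X) + f B              ≤⟨ +-monoˡ-≤ (f B) A-spans-X ⟩
    f A + f B                    ≡⟨ +-comm (f A) (f B) ⟩
    f B + f A                    ∎)
    where
    B∪X⊆ : B ∪ X ⊆ (A ∪ X) ∪ B
    B∪X⊆ = ∪-least (q⊆p∪q (A ∪ X) B) (p⊆p∪q B ∘ q⊆p∪q A X)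
    A⊆ : A ⊆ (A ∪ X) ∩ B
    A⊆ x∈A = x∈p∩q⁺ (p⊆p∪q X x∈A , A⊆B x∈A)

  spans-∪ : ∀ {A X Y} → Spans A X → Spans A Y → Spans A (X ∪ Y)
  spans-∪ {A} {X} {Y} A-spans-X A-spans-Y = begin
    f (A ∪ (X ∪ Y))  ≡⟨ cong f (sym (∪-assoc A X Y)) ⟩
    f ((A ∪ X) ∪ Y)  ≤⟨ spans-mono (p⊆p∪q X) A-spans-Y ⟩
    f (A ∪ X)        ≤⟨ A-spans-X ⟩
    f A              ∎

  spans-⋃ : ∀ {A Xs} → All (Spans A) Xs → Spans A (⋃ Xs)
  spans-⋃ []       = spans-self (λ x∈⊥ → ⊥-elim (∉⊥ x∈⊥))
  spans-⋃ (h ∷ hs) = spans-∪ h (spans-⋃ hs)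

  spans-pointwise : ∀ {A X} → (∀ e → e ∈ X → Spans A ⁅ e ⁆) → Spans A X
  spans-pointwise {A} {X} h = spans-⊆ X⊆⋃pieces (spans-⋃ (map⁺ (All.universal spans-piece (allFin m))))
    where
    piece : Fin m → Subset m
    piece e = ⁅ e ⁆ ∩ X
    spans-piece : ∀ e → Spans A (piece e)
    spans-piece e with e ∈? X
    ... | yes e∈X = spans-⊆ (p∩q⊆p ⁅ e ⁆ X) (h e e∈X)
    ... | no  e∉X = spans-self λ {x} x∈piece →
      contradiction (subst (_∈ X) (x∈⁅y⁆⇒x≡y e (p∩q⊆p ⁅ e ⁆ X x∈piece)) (p∩q⊆q ⁅ e ⁆ X x∈piece)) e∉X
    X⊆⋃pieces : X ⊆ ⋃ (map piece (allFin m))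
    X⊆⋃pieces {x} x∈X = ∈-⋃ (x∈p∩q⁺ (x∈⁅x⁆ x , x∈X)) (∈-map⁺ piece (∈-allFin x))

  tight⊆core : ∀ {b k S} → IsBasis b → IsMaxBKIn b k → S ⊆ b → Tight S → S ⊆ k
  tight⊆core {b} {k} {S} b-basis k-core S⊆b tight-S =
    core-max (k ∪ S) (p⊆p∪q S) k∪S⊆b (ind-k∪S , tight-k∪S) ∘ q⊆p∪q k S
    where
    open IsMaxBKIn k-core
    k∪S⊆b : k ∪ S ⊆ b
    k∪S⊆b = ∪-least core⊆ S⊆b
    ind-k∪S : Independent (k ∪ S)
    ind-k∪S = independent-⊆ k∪S⊆b (IsBasis.independent b-basis)
    tight-k∪S : Tight (k ∪ S)
    tight-k∪S = tight-∪ ind-k∪S (proj₂ core-BK) tight-S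

  module _ {b k : Subset m} (b-basis : IsBasis b) (k-core : IsMaxBKIn b k) where

    open IsBasis b-basis
    open IsMaxBKIn k-core

    circuit-spans : ∀ {e S} → S ⊆ b ∪ ⁅ e ⁆ → f S < ∣ S ∣ → Spans k ⁅ e ⁆
    circuit-spans {e} {S} S⊆b∪e fS<∣S∣ with e ∈? S
    ... | no e∉S = contradiction (independent S S⊆b) (<⇒≱ fS<∣S∣)
      where
      S⊆b : S ⊆ b
      S⊆b {x} x∈S with x∈p∪q⁻ b ⁅ e ⁆ (S⊆b∪e x∈S)
      ... | inj₁ x∈b = x∈b
      ... | inj₂ x∈e = contradiction (subst (_∈ S) (x∈⁅y⁆⇒x≡y e x∈e) x∈S) e∉S
    ... | yes e∈S = spans-mono S′⊆k S′-spans-e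
      where
      S′ : Subset m
      S′ = S ∩ b
      S⊆S′∪e : S ⊆ S′ ∪ ⁅ e ⁆
      S⊆S′∪e {x} x∈S with x∈p∪q⁻ b ⁅ e ⁆ (S⊆b∪e x∈S)
      ... | inj₁ x∈b = p⊆p∪q ⁅ e ⁆ (x∈p∩q⁺ (x∈S , x∈b))
      ... | inj₂ x∈e = q⊆p∪q S′ ⁅ e ⁆ x∈e
      fS≤∣S′∣ : f S ≤ ∣ S′ ∣
      fS≤∣S′∣ = m<1+n⇒m≤n (begin-strict
        f S                            <⟨ fS<∣S∣ ⟩
        ∣ S ∣                          ≤⟨ p⊆q⇒∣p∣≤∣q∣ S⊆S′∪e ⟩
        ∣ S′ ∪ ⁅ e ⁆ ∣                 ≤⟨ m≤m+n _ _ ⟩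
        ∣ S′ ∪ ⁅ e ⁆ ∣ + ∣ S′ ∩ ⁅ e ⁆ ∣  ≡⟨ ∣p∪q∣+∣p∩q∣≡∣p∣+∣q∣ S′ ⁅ e ⁆ ⟩
        ∣ S′ ∣ + ∣ ⁅ e ⁆ ∣             ≡⟨ cong (∣ S′ ∣ +_) (∣⁅x⁆∣≡1 e) ⟩
        ∣ S′ ∣ + 1                     ≡⟨ +-comm ∣ S′ ∣ 1 ⟩
        suc ∣ S′ ∣                     ∎)
      S′-tight : Tight S′
      S′-tight = ≤-antisym (≤-trans (f-mono (p∩q⊆p S b)) fS≤∣S′∣) (independent S′ (p∩q⊆q S b))
      S′⊆k : S′ ⊆ k
      S′⊆k = tight⊆core b-basis k-core (p∩q⊆q S b) S′-tight
      S′-spans-e : Spans S′ ⁅ e ⁆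
      S′-spans-e = begin
        f (S′ ∪ ⁅ e ⁆)  ≤⟨ f-mono (∪-least (p∩q⊆p S b) λ x∈e → subst (_∈ S) (sym (x∈⁅y⁆⇒x≡y e x∈e)) e∈S) ⟩
        f S             ≤⟨ fS≤∣S′∣ ⟩
        ∣ S′ ∣          ≡⟨ sym S′-tight ⟩
        f S′            ∎

    outside-spans : ∀ {e} → e ∉ b → Spans k ⁅ e ⁆
    outside-spans {e} e∉b = decidable-stable (_ ≤? _) λ ¬spans →
      e∉b (maximal (b ∪ ⁅ e ⁆) (p⊆p∪q ⁅ e ⁆) (b∪e-independent ¬spans) (x∈p∪q⁺ (inj₂ (x∈⁅x⁆ e))))
      where
      b∪e-independent : ¬ Spans k ⁅ e ⁆ → Independent (b ∪ ⁅ e ⁆)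
      b∪e-independent ¬spans S S⊆b∪e = ≮⇒≥ (¬spans ∘ circuit-spans S⊆b∪e)

    f[k∪∁b]≤∣k∣ : f (k ∪ ∁ b) ≤ ∣ k ∣
    f[k∪∁b]≤∣k∣ = subst (f (k ∪ ∁ b) ≤_) (proj₂ core-BK)
      (spans-pointwise λ e e∈∁b → outside-spans (x∈∁p⇒x∉p e∈∁b))

    ∣b∣≡∣k∣+∣b∩∁k∣ : ∣ b ∣ ≡ ∣ k ∣ + ∣ b ∩ ∁ k ∣
    ∣b∣≡∣k∣+∣b∩∁k∣ = trans (∣p∣≡∣p∩q∣+∣p∩∁q∣ b k) (cong (_+ ∣ b ∩ ∁ k ∣) ∣b∩k∣≡∣k∣)
      where
      ∣b∩k∣≡∣k∣ : ∣ b ∩ k ∣ ≡ ∣ k ∣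
      ∣b∩k∣≡∣k∣ = ≤-antisym (p⊆q⇒∣p∣≤∣q∣ (p∩q⊆q b k)) (p⊆q⇒∣p∣≤∣q∣ λ x∈k → x∈p∩q⁺ (core⊆ x∈k , x∈k))

    card-split : ∀ X → ∣ X ∣ ≤ ∣ X ∩ (k ∪ ∁ b) ∣ + ∣ b ∩ ∁ k ∣
    card-split X = begin
      ∣ X ∣                                    ≡⟨ ∣p∣≡∣p∩q∣+∣p∩∁q∣ X W ⟩
      ∣ X ∩ W ∣ + ∣ X ∩ ∁ W ∣                  ≤⟨ +-monoʳ-≤ ∣ X ∩ W ∣ (p⊆q⇒∣p∣≤∣q∣ X∖W⊆b∖k) ⟩
      ∣ X ∩ W ∣ + ∣ b ∩ ∁ k ∣                  ∎
      where
      W : Subset m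
      W = k ∪ ∁ b
      X∖W⊆b∖k : X ∩ ∁ W ⊆ b ∩ ∁ k
      X∖W⊆b∖k {x} x∈X∖W = x∈p∩q⁺ (x∈b , x∉p⇒x∈∁p (x∉W ∘ p⊆p∪q (∁ b)))
        where
        x∉W : x ∉ W
        x∉W = x∈∁p⇒x∉p (p∩q⊆q X (∁ W) x∈X∖W)
        x∈b : x ∈ b
        x∈b with x ∈? b
        ... | yes x∈b = x∈b
        ... | no  x∉b = contradiction (q⊆p∪q k (∁ b) (x∉p⇒x∈∁p x∉b)) x∉W

    independent-card≤ : ∀ {X} → Independent X → ∣ X ∣ ≤ ∣ b ∣
    independent-card≤ {X} ind-X = begin
      ∣ X ∣                        ≤⟨ card-split X ⟩
      ∣ T ∣ + ∣ b ∩ ∁ k ∣          ≤⟨ +-monoˡ-≤ ∣ b ∩ ∁ k ∣ ∣T∣≤∣k∣ ⟩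
      ∣ k ∣ + ∣ b ∩ ∁ k ∣          ≡⟨ sym ∣b∣≡∣k∣+∣b∩∁k∣ ⟩
      ∣ b ∣                        ∎
      where
      T : Subset m
      T = X ∩ (k ∪ ∁ b)
      ∣T∣≤∣k∣ : ∣ T ∣ ≤ ∣ k ∣
      ∣T∣≤∣k∣ = ≤-trans (ind-X T (p∩q⊆p X _)) (≤-trans (f-mono (p∩q⊆q X _)) f[k∪∁b]≤∣k∣)

    core-card-mono : ∀ {b′ k′} → IsBasis b′ → IsMaxBKIn b′ k′ → ∣ b ∣ ≤ ∣ b′ ∣ → ∣ k ∣ ≤ ∣ k′ ∣
    core-card-mono {b′} {k′} b′-basis k′-core ∣b∣≤∣b′∣ =
      ≤-trans ∣k∣≤∣T∣ (p⊆q⇒∣p∣≤∣q∣ (tight⊆core b′-basis k′-core (p∩q⊆p b′ _) T-tight))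
      where
      T : Subset m
      T = b′ ∩ (k ∪ ∁ b)
      ∣k∣≤∣T∣ : ∣ k ∣ ≤ ∣ T ∣
      ∣k∣≤∣T∣ = +-cancelʳ-≤ ∣ b ∩ ∁ k ∣ _ _ (begin
        ∣ k ∣ + ∣ b ∩ ∁ k ∣  ≡⟨ sym ∣b∣≡∣k∣+∣b∩∁k∣ ⟩
        ∣ b ∣                ≤⟨ ∣b∣≤∣b′∣ ⟩
        ∣ b′ ∣               ≤⟨ card-split b′ ⟩
        ∣ T ∣ + ∣ b ∩ ∁ k ∣  ∎)
      T-tight : Tight T
      T-tight = ≤-antisym (≤-trans (≤-trans (f-mono (p∩q⊆q b′ _)) f[k∪∁b]≤∣k∣) ∣k∣≤∣T∣)
                          (IsBasis.independent b′-basis T (p∩q⊆p b′ _))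

  maxBK-card-unique : ∀ {b k b′ k′} → IsBasis b → IsMaxBKIn b k → IsBasis b′ → IsMaxBKIn b′ k′ → ∣ k ∣ ≡ ∣ k′ ∣
  maxBK-card-unique b-basis k-core b′-basis k′-core = ≤-antisym
    (core-card-mono b-basis k-core b′-basis k′-core
      (independent-card≤ b′-basis k′-core (IsBasis.independent b-basis)))
    (core-card-mono b′-basis k′-core b-basis k-core
      (independent-card≤ b-basis k-core (IsBasis.independent b′-basis)))

module Coordinates {c ℓ} (K : Field c ℓ) where

  open Field K hiding (zero) renaming (refl to ≈-refl; sym to ≈-sym; trans to ≈-trans)
  open import Algebra.Properties.Ring ring using (-‿distribʳ-*)
  open import Algebra.Solver.Ring.NaturalCoefficients.Default commutativeSemiring
  open import Data.Vec.Functional.Relation.Binary.Equality.Setoid setoid using (≋-sym; ≋-trans)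
  open import Relation.Binary.Reasoning.Setoid setoid

  V : ℕ → Set c
  V = LinearAlgebra.V K

  module _ {d : ℕ} where
    open LinearAlgebra K d public using (_≈ᵥ_; 0ᵥ; _+ᵥ_; _·_; lincomb; Independent; Dim)

  x*y≈1⇒x*-y+1≈0 : ∀ {x y} → x * y ≈ 1# → x * (- y) + 1# ≈ 0#
  x*y≈1⇒x*-y+1≈0 {x} {y} x*y≈1 = begin
    x * (- y) + 1#      ≈⟨ +-cong (≈-sym (-‿distribʳ-* x y)) (≈-sym x*y≈1) ⟩
    - (x * y) + x * y   ≈⟨ -‿inverseˡ (x * y) ⟩
    0#                  ∎

  x*y≈1⇒z*x≈0⇒z≈0 : ∀ {x y z} → x * y ≈ 1# → z * x ≈ 0# → z ≈ 0#
  x*y≈1⇒z*x≈0⇒z≈0 {x} {y} {z} x*y≈1 z*x≈0 = begin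
    z             ≈⟨ ≈-sym (*-identityʳ z) ⟩
    z * 1#        ≈⟨ *-congˡ (≈-sym x*y≈1) ⟩
    z * (x * y)   ≈⟨ ≈-sym (*-assoc z x y) ⟩
    (z * x) * y   ≈⟨ *-congʳ z*x≈0 ⟩
    0# * y        ≈⟨ zeroˡ y ⟩
    0#            ∎

  a*t+1≈0⇒b+a*t*b≈0 : ∀ {a t} b → a * t + 1# ≈ 0# → b + (a * t) * b ≈ 0#
  a*t+1≈0⇒b+a*t*b≈0 {a} {t} b a*t+1≈0 = begin
    b + (a * t) * b    ≈⟨ solve 3 (λ a t b → b :+ (a :* t) :* b := b :* (a :* t :+ con 1)) ≈-refl a t b ⟩
    b * (a * t + 1#)   ≈⟨ *-congˡ a*t+1≈0 ⟩
    b * 0#             ≈⟨ zeroʳ b ⟩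
    0#                 ∎

  x*y≈1⇒x*u+v≈0⇒-y*v≈u : ∀ {x y u v} → x * y ≈ 1# → x * u + v ≈ 0# → (- y) * v ≈ u
  x*y≈1⇒x*u+v≈0⇒-y*v≈u {x} {y} {u} {v} x*y≈1 x*u+v≈0 = begin
    (- y) * v                               ≈⟨ ≈-sym (+-identityʳ _) ⟩
    (- y) * v + 0#                          ≈⟨ +-congˡ (≈-sym (zeroʳ u)) ⟩
    (- y) * v + u * 0#                      ≈⟨ +-congˡ (*-congˡ (≈-sym (x*y≈1⇒x*-y+1≈0 x*y≈1))) ⟩
    (- y) * v + u * (x * (- y) + 1#)        ≈⟨ solve 4 (λ n v u x → n :* v :+ u :* (x :* n :+ con 1)
                                                          := u :+ n :* (x :* u :+ v)) ≈-refl (- y) v u x ⟩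
    u + (- y) * (x * u + v)                 ≈⟨ +-congˡ (≈-trans (*-congˡ x*u+v≈0) (zeroʳ (- y))) ⟩
    u + 0#                                  ≈⟨ +-identityʳ u ⟩
    u                                       ∎

  lincombᶠ : ∀ {n d} → (Fin n → V d) → V n → V d
  lincombᶠ {zero}  F cs = 0ᵥ
  lincombᶠ {suc n} F cs = (cs zero · F zero) +ᵥ lincombᶠ (F ∘ suc) (cs ∘ suc)

  Independentᶠ : ∀ {n d} → (Fin n → V d) → Set (c ⊔ ℓ)
  Independentᶠ F = ∀ cs → lincombᶠ F cs ≈ᵥ 0ᵥ → cs ≈ᵥ 0ᵥ

  Dependentᶠ : ∀ {n d} → (Fin n → V d) → Set (c ⊔ ℓ)
  Dependentᶠ {n} F = Σ (V n) λ cs → lincombᶠ F cs ≈ᵥ 0ᵥ × ∃ λ i → ¬ cs i ≈ 0#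

  record IsLinear {d d′} (φ : V d → V d′) : Set (c ⊔ ℓ) where
    field
      map-0ᵥ : φ 0ᵥ ≈ᵥ 0ᵥ
      map-·+ : ∀ a u v → φ ((a · u) +ᵥ v) ≈ᵥ ((a · φ u) +ᵥ φ v)

  module _ {d : ℕ} where

    lincomb≡lincombᶠ : ∀ (ws : List (V d)) cs → lincomb ws cs ≡ lincombᶠ (lookup ws) cs
    lincomb≡lincombᶠ []       cs = refl
    lincomb≡lincombᶠ (w ∷ ws) cs = cong ((cs zero · w) +ᵥ_) (lincomb≡lincombᶠ ws (cs ∘ suc))

    independent⇒independentᶠ : ∀ (ws : List (V d)) → Independent ws → Independentᶠ (lookup ws)
    independent⇒independentᶠ ws ws-ind cs rel = ws-ind cs (subst (_≈ᵥ 0ᵥ) (sym (lincomb≡lincombᶠ ws cs)) rel)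

    independentᶠ⇒independent : ∀ (ws : List (V d)) → Independentᶠ (lookup ws) → Independent ws
    independentᶠ⇒independent ws ws-ind cs rel = ws-ind cs (subst (_≈ᵥ 0ᵥ) (lincomb≡lincombᶠ ws cs) rel)

    lincombᶠ-congˡ : ∀ {n} {F G : Fin n → V d} → (∀ i → F i ≈ᵥ G i) → ∀ cs → lincombᶠ F cs ≈ᵥ lincombᶠ G cs
    lincombᶠ-congˡ {zero}  F≈G cs k = ≈-refl
    lincombᶠ-congˡ {suc n} F≈G cs k = +-cong (*-congˡ (F≈G zero k)) (lincombᶠ-congˡ (F≈G ∘ suc) (cs ∘ suc) k)

    lincombᶠ-zero : ∀ {n} (F : Fin n → V d) {cs} → cs ≈ᵥ 0ᵥ → lincombᶠ F cs ≈ᵥ 0ᵥ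
    lincombᶠ-zero {zero}  F cs≈0 k = ≈-refl
    lincombᶠ-zero {suc n} F cs≈0 k = ≈-trans
      (+-cong (≈-trans (*-congʳ (cs≈0 zero)) (zeroˡ (F zero k))) (lincombᶠ-zero (F ∘ suc) (cs≈0 ∘ suc) k))
      (+-identityʳ 0#)

    lincombᶠ-scale : ∀ {n} (F : Fin n → V d) a cs → lincombᶠ F (a · cs) ≈ᵥ (a · lincombᶠ F cs)
    lincombᶠ-scale {zero}  F a cs k = ≈-sym (zeroʳ a)
    lincombᶠ-scale {suc n} F a cs k = ≈-trans
      (+-cong (*-assoc a (cs zero) (F zero k)) (lincombᶠ-scale (F ∘ suc) a (cs ∘ suc) k))
      (≈-sym (distribˡ a _ _))

    lincombᶠ-isLinear : ∀ {n} (F : Fin n → V d) → IsLinear (lincombᶠ F)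
    lincombᶠ-isLinear F = record { map-0ᵥ = lincombᶠ-zero F (λ _ → ≈-refl) ; map-·+ = ·+ F }
      where
      ·+ : ∀ {n} (F : Fin n → V d) a u v →
           lincombᶠ F ((a · u) +ᵥ v) ≈ᵥ ((a · lincombᶠ F u) +ᵥ lincombᶠ F v)
      ·+ {zero}  F a u v k = ≈-sym (≈-trans (+-congʳ (zeroʳ a)) (+-identityʳ 0#))
      ·+ {suc n} F a u v k = ≈-trans (+-congˡ (·+ (F ∘ suc) a (u ∘ suc) (v ∘ suc) k))
        (solve 6 (λ a u₀ v₀ x U W → (a :* u₀ :+ v₀) :* x :+ (a :* U :+ W)
                                   := a :* (u₀ :* x :+ U) :+ (v₀ :* x :+ W))
               ≈-refl a (u zero) (v zero) (F zero k) _ _)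

  lincombᶠ-map : ∀ {n d d′} {φ : V d → V d′} → IsLinear φ → ∀ (F : Fin n → V d) cs →
                 φ (lincombᶠ F cs) ≈ᵥ lincombᶠ (φ ∘ F) cs
  lincombᶠ-map {zero}  φ-linear F cs = IsLinear.map-0ᵥ φ-linear
  lincombᶠ-map {suc n} φ-linear F cs k = ≈-trans (IsLinear.map-·+ φ-linear (cs zero) (F zero) _ k)
    (+-congˡ (lincombᶠ-map φ-linear (F ∘ suc) (cs ∘ suc) k))

  module Elimination {d} (x : V (suc d)) (j : Fin (suc d)) (t : Carrier) (x[j]*t+1≈0 : x j * t + 1# ≈ 0#) where

    -- As x j * t ≈ -1, adding (v j * t) · x clears coordinate j, which punchIn then skips.
    eliminate : V (suc d) → V d
    eliminate v k = v (punchIn j k) + (v j * t) * x (punchIn j k)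

    eliminate-cong : ∀ {u v} → u ≈ᵥ v → eliminate u ≈ᵥ eliminate v
    eliminate-cong u≈v k = +-cong (u≈v (punchIn j k)) (*-congʳ (*-congʳ (u≈v j)))

    eliminate-isLinear : IsLinear eliminate
    eliminate-isLinear = record
      { map-0ᵥ = λ k → ≈-trans (+-identityˡ _) (≈-trans (*-congʳ (zeroˡ t)) (zeroˡ _))
      ; map-·+ = λ a u v k → solve 7
          (λ a uₖ vₖ uⱼ vⱼ t xₖ → a :* uₖ :+ vₖ :+ ((a :* uⱼ :+ vⱼ) :* t) :* xₖ
                                 := a :* (uₖ :+ (uⱼ :* t) :* xₖ) :+ (vₖ :+ (vⱼ :* t) :* xₖ))
          ≈-refl a (u (punchIn j k)) (v (punchIn j k)) (u j) (v j) t (x (punchIn j k))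
      }

    eliminate-pivot : eliminate x ≈ᵥ 0ᵥ
    eliminate-pivot k = a*t+1≈0⇒b+a*t*b≈0 (x (punchIn j k)) x[j]*t+1≈0

    eliminate≈0⇒ : ∀ {v} → eliminate v ≈ᵥ 0ᵥ → (((v j * t) · x) +ᵥ v) ≈ᵥ 0ᵥ
    eliminate≈0⇒ {v} v↦0 k with j ≟ᶠ k
    ... | yes refl = begin
      (v j * t) * x j + v j  ≈⟨ solve 3 (λ vⱼ t xⱼ → (vⱼ :* t) :* xⱼ :+ vⱼ := vⱼ :+ (xⱼ :* t) :* vⱼ)
                                        ≈-refl (v j) t (x j) ⟩
      v j + (x j * t) * v j  ≈⟨ a*t+1≈0⇒b+a*t*b≈0 (v j) x[j]*t+1≈0 ⟩
      0#                     ∎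
    ... | no j≢k = subst (λ k → (v j * t) * x k + v k ≈ 0#) (punchIn-punchOut j≢k)
                         (≈-trans (+-comm _ _) (v↦0 (punchOut j≢k)))

  ¬¬-zero-or-pivot : ∀ {d} (x : V d) → ¬ ¬ (x ≈ᵥ 0ᵥ ⊎ ∃ λ j → ¬ x j ≈ 0#)
  ¬¬-zero-or-pivot x = ¬¬-map decide (¬¬-∀-Fin λ j → ¬¬-excluded-middle)
    where
    decide : (∀ j → Dec (x j ≈ 0#)) → x ≈ᵥ 0ᵥ ⊎ ∃ λ j → ¬ x j ≈ 0#
    decide x≟0 with any? (¬? ∘ x≟0)
    ... | yes pivot  = inj₂ pivot
    ... | no ¬pivot = inj₁ λ j → decidable-stable (x≟0 j) (¬pivot ∘ (j ,_))

  head≈0⇒dependent : ∀ {n d} (F : Fin (suc n) → V d) → F zero ≈ᵥ 0ᵥ → Dependentᶠ F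
  head≈0⇒dependent {n} F F₀≈0 = cs , rel , zero , 0≉1 ∘ ≈-sym
    where
    cs : V (suc n)
    cs = λ { zero → 1# ; (suc _) → 0# }
    rel : lincombᶠ F cs ≈ᵥ 0ᵥ
    rel k = ≈-trans (+-cong (≈-trans (*-identityˡ _) (F₀≈0 k)) (lincombᶠ-zero (F ∘ suc) (λ _ → ≈-refl) k))
                    (+-identityʳ 0#)

  module Pivot {n d} (F : Fin (suc n) → V (suc d)) (j : Fin (suc d)) (F₀[j]≉0 : ¬ F zero j ≈ 0#) where

    x : V (suc d)
    x = F zero

    y : Carrier
    y = proj₁ (inverse (x j) F₀[j]≉0)

    x[j]*y≈1 : x j * y ≈ 1#
    x[j]*y≈1 = proj₂ (inverse (x j) F₀[j]≉0)

    t : Carrier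
    t = - y

    open Elimination x j t (x*y≈1⇒x*-y+1≈0 x[j]*y≈1) public

    F′ : Fin n → V d
    F′ = eliminate ∘ F ∘ suc

    lift-dependent : Dependentᶠ F′ → Dependentᶠ F
    lift-dependent (cs , rel , i , cs[i]≉0) =
      (λ { zero → S j * t ; (suc i) → cs i }) , S-relation , suc i , cs[i]≉0
      where
      S : V (suc d)
      S = lincombᶠ (F ∘ suc) cs
      S-relation : (((S j * t) · x) +ᵥ S) ≈ᵥ 0ᵥ
      S-relation = eliminate≈0⇒ (≋-trans (lincombᶠ-map eliminate-isLinear (F ∘ suc) cs) rel)

    lift-independent : Independentᶠ F′ → Independentᶠ F
    lift-independent F′-ind cs rel = λ { zero → cs₀≈0 ; (suc i) → tail≈0 i }
      where
      S : V (suc d)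
      S = lincombᶠ (F ∘ suc) (cs ∘ suc)
      eliminate-S≈0 : eliminate S ≈ᵥ 0ᵥ
      eliminate-S≈0 k = begin
        eliminate S k                            ≈⟨ ≈-sym (+-identityˡ _) ⟩
        0# + eliminate S k                       ≈⟨ +-congʳ (≈-sym (≈-trans (*-congˡ (eliminate-pivot k)) (zeroʳ _))) ⟩
        cs zero * eliminate x k + eliminate S k  ≈⟨ ≈-sym (map-·+ (cs zero) x S k) ⟩
        eliminate ((cs zero · x) +ᵥ S) k         ≈⟨ eliminate-cong rel k ⟩
        eliminate 0ᵥ k                           ≈⟨ map-0ᵥ k ⟩
        0#                                       ∎
        where open IsLinear eliminate-isLinear
      tail≈0 : (cs ∘ suc) ≈ᵥ 0ᵥ
      tail≈0 = F′-ind (cs ∘ suc)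
        (≋-trans (≋-sym (lincombᶠ-map eliminate-isLinear (F ∘ suc) (cs ∘ suc))) eliminate-S≈0)
      cs₀*x[j]≈0 : cs zero * x j ≈ 0#
      cs₀*x[j]≈0 = begin
        cs zero * x j        ≈⟨ ≈-sym (+-identityʳ _) ⟩
        cs zero * x j + 0#   ≈⟨ +-congˡ (≈-sym (lincombᶠ-zero (F ∘ suc) tail≈0 j)) ⟩
        cs zero * x j + S j  ≈⟨ rel j ⟩
        0#                   ∎
      cs₀≈0 : cs zero ≈ 0#
      cs₀≈0 = x*y≈1⇒z*x≈0⇒z≈0 x[j]*y≈1 cs₀*x[j]≈0

  gaussian-elimination : ∀ n d (F : Fin n → V d) → ¬ ¬ (Dependentᶠ F ⊎ Independentᶠ F × n ≤ d)
  gaussian-elimination zero    d       F = pure (inj₂ ((λ _ _ ()) , z≤n))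
  gaussian-elimination (suc n) zero    F = pure (inj₁ (head≈0⇒dependent F λ ()))
  gaussian-elimination (suc n) (suc d) F = ¬¬-zero-or-pivot (F zero) >>= λ where
    (inj₁ F₀≈0)          → pure (inj₁ (head≈0⇒dependent F F₀≈0))
    (inj₂ (j , F₀[j]≉0)) → let open Pivot F j F₀[j]≉0 in
      ¬¬-map (Sum.map lift-dependent (Product.map lift-independent s≤s)) (gaussian-elimination n d F′)

  module _ {d : ℕ} where

    record InSpan (ws : List (V d)) (v : V d) : Set (c ⊔ ℓ) where
      constructor span
      field
        coefficients : V (length ws)
        lincomb≈     : lincombᶠ (lookup ws) coefficients ≈ᵥ v

    independent-in-span⇒length≤ : ∀ {us ws : List (V d)} → Independent us → All (InSpan ws) us →
                                  length us ≤ length ws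
    independent-in-span⇒length≤ {us} {ws} us-ind us-in-span =
      decidable-stable (length us ≤? length ws) (gaussian-elimination _ _ coords >>= λ where
        (inj₁ (cs , rel , i , cs[i]≉0)) → contradiction (coords-independent cs rel i) cs[i]≉0
        (inj₂ (_ , length≤))           → pure length≤)
      where
      coords : Fin (length us) → V (length ws)
      coords i = InSpan.coefficients (All.lookup us-in-span (∈-lookup i))
      coords-independent : Independentᶠ coords
      coords-independent cs rel = independent⇒independentᶠ us us-ind cs λ k → begin
        lincombᶠ (lookup us) cs k                      ≈⟨ lincombᶠ-congˡ us≈ws·coords cs k ⟩
        lincombᶠ (lincombᶠ (lookup ws) ∘ coords) cs k
          ≈⟨ ≈-sym (lincombᶠ-map (lincombᶠ-isLinear (lookup ws)) coords cs k) ⟩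
        lincombᶠ (lookup ws) (lincombᶠ coords cs) k    ≈⟨ lincombᶠ-zero (lookup ws) rel k ⟩
        0#                                             ∎
        where
        us≈ws·coords : ∀ i → lookup us i ≈ᵥ lincombᶠ (lookup ws) (coords i)
        us≈ws·coords i = ≋-sym (InSpan.lincomb≈ (All.lookup us-in-span (∈-lookup i)))

    ¬¬-dependent-or-independent : ∀ (ws : List (V d)) → ¬ ¬ (Dependentᶠ (lookup ws) ⊎ Independent ws)
    ¬¬-dependent-or-independent ws =
      ¬¬-map (Sum.map₂ (independentᶠ⇒independent ws ∘ proj₁)) (gaussian-elimination _ _ (lookup ws))

    InSpan-∷ : ∀ {ws v} w → InSpan ws v → InSpan (w ∷ ws) v
    InSpan-∷ w (span cs cs-spans) = span (λ { zero → 0# ; (suc i) → cs i })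
      λ k → ≈-trans (+-congʳ (zeroˡ (w k))) (≈-trans (+-identityˡ _) (cs-spans k))

    InSpan-++ : ∀ {ws v} us → InSpan ws v → InSpan (us ++ ws) v
    InSpan-++ []       = id
    InSpan-++ (u ∷ us) = InSpan-∷ u ∘ InSpan-++ us

    ∈⇒InSpan : ∀ {ws v} → v ∈ₗ ws → InSpan ws v
    ∈⇒InSpan {w ∷ ws} (here refl) = span (λ { zero → 1# ; (suc i) → 0# })
      λ k → ≈-trans (+-cong (*-identityˡ (w k)) (lincombᶠ-zero (lookup ws) (λ _ → ≈-refl) k))
                    (+-identityʳ (w k))
    ∈⇒InSpan {w ∷ ws} (there v∈ws) = InSpan-∷ w (∈⇒InSpan v∈ws)

    dependent-∷⇒InSpan : ∀ {x} {G : List (V d)} → Independent G → Dependentᶠ (lookup (x ∷ G)) → InSpan G x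
    dependent-∷⇒InSpan {x} {G} G-ind (cs , rel , i , cs[i]≉0) =
      span ((- y) · (cs ∘ suc)) λ k → ≈-trans (lincombᶠ-scale (lookup G) (- y) (cs ∘ suc) k)
                                            (x*y≈1⇒x*u+v≈0⇒-y*v≈u cs₀*y≈1 (rel k))
      where
      cs₀≉0 : ¬ cs zero ≈ 0#
      cs₀≉0 cs₀≈0 = cs[i]≉0 (cs≈0 i)
        where
        tail≈0 : (cs ∘ suc) ≈ᵥ 0ᵥ
        tail≈0 = independent⇒independentᶠ G G-ind (cs ∘ suc) λ k →
          ≈-trans (≈-sym (≈-trans (+-congʳ (≈-trans (*-congʳ cs₀≈0) (zeroˡ (x k)))) (+-identityˡ _))) (rel k)
        cs≈0 : cs ≈ᵥ 0ᵥ
        cs≈0 zero    = cs₀≈0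
        cs≈0 (suc i) = tail≈0 i
      y : Carrier
      y = proj₁ (inverse (cs zero) cs₀≉0)
      cs₀*y≈1 : cs zero * y ≈ 1#
      cs₀*y≈1 = proj₂ (inverse (cs zero) cs₀≉0)

    pad : ∀ {us ws : List (V d)} → us ⊑ ws → V (length us) → V (length ws)
    pad (_ ∷ʳ us⊑ws) cs zero    = 0#
    pad (_ ∷ʳ us⊑ws) cs (suc i) = pad us⊑ws cs i
    pad (_ ∷ us⊑ws)  cs zero    = cs zero
    pad (_ ∷ us⊑ws)  cs (suc i) = pad us⊑ws (cs ∘ suc) i

    position : ∀ {us ws : List (V d)} → us ⊑ ws → Fin (length us) → Fin (length ws)
    position (_ ∷ʳ us⊑ws) i       = suc (position us⊑ws i)
    position (_ ∷ us⊑ws)  zero    = zero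
    position (_ ∷ us⊑ws)  (suc i) = suc (position us⊑ws i)

    pad-position : ∀ {us ws : List (V d)} (us⊑ws : us ⊑ ws) cs i → pad us⊑ws cs (position us⊑ws i) ≡ cs i
    pad-position (_ ∷ʳ us⊑ws) cs i       = pad-position us⊑ws cs i
    pad-position (_ ∷ us⊑ws)  cs zero    = refl
    pad-position (_ ∷ us⊑ws)  cs (suc i) = pad-position us⊑ws (cs ∘ suc) i

    lincombᶠ-pad : ∀ {us ws : List (V d)} (us⊑ws : us ⊑ ws) cs →
                   lincombᶠ (lookup ws) (pad us⊑ws cs) ≈ᵥ lincombᶠ (lookup us) cs
    lincombᶠ-pad []              cs k = ≈-refl
    lincombᶠ-pad (w ∷ʳ us⊑ws)    cs k =
      ≈-trans (+-congʳ (zeroˡ (w k))) (≈-trans (+-identityˡ _) (lincombᶠ-pad us⊑ws cs k))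
    lincombᶠ-pad (refl ∷ us⊑ws)  cs k = +-congˡ (lincombᶠ-pad us⊑ws (cs ∘ suc) k)

    independent-⊑ : ∀ {us ws : List (V d)} → us ⊑ ws → Independent ws → Independent us
    independent-⊑ {us} {ws} us⊑ws ws-ind = independentᶠ⇒independent us λ cs rel i →
      subst (_≈ 0#) (pad-position us⊑ws cs i)
        (independent⇒independentᶠ ws ws-ind (pad us⊑ws cs) (≋-trans (lincombᶠ-pad us⊑ws cs) rel)
                                  (position us⊑ws i))

    ¬¬-extend-to-spanning : ∀ (acc ws : List (V d)) → Independent acc →
      ¬ ¬ (Σ (List (V d)) λ G → G ⊑ ws × Independent (G ++ acc) × All (InSpan (G ++ acc)) ws)
    ¬¬-extend-to-spanning acc []       acc-ind = pure ([] , [] , acc-ind , [])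
    ¬¬-extend-to-spanning acc (x ∷ ws) acc-ind = do
      (G , G⊑ws , G-ind , ws-in-span) ← ¬¬-extend-to-spanning acc ws acc-ind
      ¬¬-dependent-or-independent (x ∷ G ++ acc) >>= λ where
        (inj₁ x∷G-dep) → pure (G , x ∷ʳ G⊑ws , G-ind , dependent-∷⇒InSpan G-ind x∷G-dep ∷ ws-in-span)
        (inj₂ x∷G-ind) → pure (x ∷ G , refl ∷ G⊑ws , x∷G-ind ,
                               ∈⇒InSpan (here refl) ∷ All.map (InSpan-∷ x) ws-in-span)

    ¬¬-spanning-sublist : ∀ (ws : List (V d)) →
      ¬ ¬ (Σ (List (V d)) λ G → G ⊑ ws × Independent G × All (InSpan G) ws)
    ¬¬-spanning-sublist ws = ¬¬-map drop-[] (¬¬-extend-to-spanning [] ws (λ _ _ ()))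
      where
      drop-[] : (Σ (List (V d)) λ G → G ⊑ ws × Independent (G ++ []) × All (InSpan (G ++ [])) ws) →
                Σ (List (V d)) λ G → G ⊑ ws × Independent G × All (InSpan G) ws
      drop-[] (G , G⊑ws , G-ind , ws-in-span) rewrite ++-identityʳ G = G , G⊑ws , G-ind , ws-in-span

    dim-unique : ∀ {ws : List (V d)} {r s} → Dim ws r → Dim ws s → r ≡ s
    dim-unique ((us , us⊑ws , us-ind , refl) , ≤r) ((vs , vs⊑ws , vs-ind , refl) , ≤s) =
      ≤-antisym (≤s us us⊑ws us-ind) (≤r vs vs⊑ws vs-ind)

    ¬¬-dim : ∀ (ws : List (V d)) → ¬ ¬ Σ ℕ (Dim ws)
    ¬¬-dim ws = ¬¬-map dim-of (¬¬-spanning-sublist ws)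
      where
      dim-of : (Σ (List (V d)) λ G → G ⊑ ws × Independent G × All (InSpan G) ws) → Σ ℕ (Dim ws)
      dim-of (G , G⊑ws , G-ind , ws-in-span) = length G , (G , G⊑ws , G-ind , refl) ,
        λ us us⊑ws us-ind → independent-in-span⇒length≤ us-ind (All-resp-⊆ us⊑ws ws-in-span)

    dim≤length : ∀ {ws us : List (V d)} {r} → Dim ws r → All (InSpan us) ws → r ≤ length us
    dim≤length ((vs , vs⊑ws , vs-ind , refl) , _) ws-in-span =
      independent-in-span⇒length≤ vs-ind (All-resp-⊆ vs⊑ws ws-in-span)

    length≤dim : ∀ {ws us : List (V d)} {r} → Dim ws r → Independent us → All (_∈ₗ ws) us → length us ≤ r
    length≤dim {ws} {us} (_ , maximal) us-ind us⊆ws = decidable-stable (_ ≤? _) (do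
      (G , G⊑ws , G-ind , ws-in-span) ← ¬¬-spanning-sublist ws
      pure (≤-trans (independent-in-span⇒length≤ us-ind (All.map (All.lookup ws-in-span) us⊆ws))
                    (maximal G G⊑ws G-ind)))

    dim-mono : ∀ {us ws : List (V d)} {r s} → (∀ {v} → v ∈ₗ us → v ∈ₗ ws) → Dim us r → Dim ws s → r ≤ s
    dim-mono us⊆ws ((vs , vs⊑us , vs-ind , refl) , _) ws-dim =
      length≤dim ws-dim vs-ind (All.tabulate (us⊆ws ∘ SL.lookup vs⊑us))

    dim-submodular : ∀ {as bs us is : List (V d)} {a b u i} →
      (∀ {v} → v ∈ₗ us → v ∈ₗ as ⊎ v ∈ₗ bs) → (∀ {v} → v ∈ₗ is → v ∈ₗ as × v ∈ₗ bs) →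
      Dim as a → Dim bs b → Dim us u → Dim is i → u Nat.+ i ≤ a Nat.+ b
    dim-submodular {as} {bs} {us} {is} {a} {b} {u} {i} us⊆as∪bs is⊆as∩bs as-dim bs-dim us-dim is-dim =
      decidable-stable (_ ≤? _) (do
        (I , I⊑is , I-ind , is-in-span)    ← ¬¬-spanning-sublist is
        (F , F⊑as , F+I-ind , as-in-span)  ← ¬¬-extend-to-spanning I as I-ind
        (E , E⊑bs , E+F+I-ind , bs-in-span) ← ¬¬-extend-to-spanning (F ++ I) bs F+I-ind
        let as∪bs-in-span : ∀ {v} → v ∈ₗ as ⊎ v ∈ₗ bs → InSpan (E ++ F ++ I) v
            as∪bs-in-span = [ InSpan-++ E ∘ All.lookup as-in-span , All.lookup bs-in-span ]′
            u≤ : u ≤ length E Nat.+ length (F ++ I)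
            u≤ = subst (u ≤_) (length-++ E) (dim≤length us-dim (All.tabulate (as∪bs-in-span ∘ us⊆as∪bs)))
            I⊆is : All (_∈ₗ is) I
            I⊆is = All.tabulate (SL.lookup I⊑is)
            F+I≤a : length (F ++ I) ≤ a
            F+I≤a = length≤dim as-dim F+I-ind
                      (++⁺ (All.tabulate (SL.lookup F⊑as)) (All.map (proj₁ ∘ is⊆as∩bs) I⊆is))
            E+I-ind : Independent (E ++ I)
            E+I-ind = independent-⊑ {E ++ I} {E ++ F ++ I}
                        (SLₚ.++⁺ (SL.⊆-refl {x = E}) (SLₚ.++⁺ˡ F (SL.⊆-refl {x = I}))) E+F+I-ind
            E+I≤b : length E Nat.+ length I ≤ b
            E+I≤b = subst (_≤ b) (length-++ E)
                      (length≤dim bs-dim E+I-ind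
                        (++⁺ (All.tabulate (SL.lookup E⊑bs)) (All.map (proj₂ ∘ is⊆as∩bs) I⊆is)))
        pure (+-regroup-≤ u≤ (dim≤length is-dim is-in-span) F+I≤a E+I≤b))

module Generators {c ℓ} (K : Field c ℓ) {d m : ℕ} (n : LinearAlgebra.Tuple K d m) where

  open LinearAlgebra K d using (gens)

  gens-∈⁺ : ∀ {X i v} → i ∈ X → v ∈ₗ n i → v ∈ₗ gens n X
  gens-∈⁺ {X} {i} {v} i∈X v∈nᵢ =
    ∈-concat⁺′ (selected (i ∈? X)) (∈-map⁺ (λ i → if does (i ∈? X) then n i else []) (∈-allFin i))
    where
    selected : (i∈?X : Dec (i ∈ X)) → v ∈ₗ (if does i∈?X then n i else [])
    selected (yes _)  = v∈nᵢ
    selected (no i∉X) = contradiction i∈X i∉X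

  gens-∈⁻ : ∀ {X v} → v ∈ₗ gens n X → ∃ λ i → i ∈ X × v ∈ₗ n i
  gens-∈⁻ {X} {v} v∈gens with ∈-concat⁻′ (map (λ i → if does (i ∈? X) then n i else []) (allFin m)) v∈gens
  ... | vs , v∈vs , vs∈ with ∈-map⁻ (λ i → if does (i ∈? X) then n i else []) vs∈
  ... | i , _ , refl = i , selected (i ∈? X) v∈vs
    where
    selected : (i∈?X : Dec (i ∈ X)) → v ∈ₗ (if does i∈?X then n i else []) → i ∈ X × v ∈ₗ n i
    selected (yes i∈X) v∈nᵢ = i∈X , v∈nᵢ
    selected (no _)    ()

  gens-mono : ∀ {X Y v} → X ⊆ Y → v ∈ₗ gens n X → v ∈ₗ gens n Y
  gens-mono X⊆Y v∈gens with gens-∈⁻ v∈gens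
  ... | i , i∈X , v∈nᵢ = gens-∈⁺ (X⊆Y i∈X) v∈nᵢ

  gens-∪⁻ : ∀ X Y {v} → v ∈ₗ gens n (X ∪ Y) → v ∈ₗ gens n X ⊎ v ∈ₗ gens n Y
  gens-∪⁻ X Y v∈gens with gens-∈⁻ v∈gens
  ... | i , i∈X∪Y , v∈nᵢ = Sum.map (λ i∈X → gens-∈⁺ i∈X v∈nᵢ) (λ i∈Y → gens-∈⁺ i∈Y v∈nᵢ) (x∈p∪q⁻ X Y i∈X∪Y)

  gens-∩⁻ : ∀ X Y {v} → v ∈ₗ gens n (X ∩ Y) → v ∈ₗ gens n X × v ∈ₗ gens n Y
  gens-∩⁻ X Y v∈gens = gens-mono (p∩q⊆p X Y) v∈gens , gens-mono (p∩q⊆q X Y) v∈gens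

module MinkowskiMatroid {c ℓ} (K : Field c ℓ) {d m : ℕ} (n : LinearAlgebra.Tuple K d m)
  (rank : ∀ X → Σ ℕ (LinearAlgebra.Dim K d (LinearAlgebra.gens K d n X))) where

  open import Data.Integer using (+_; _-_; +≤+) renaming (_≤_ to _ℤ≤_)
  open import Data.Integer.Properties using (+-injective; drop‿+≤+; i-j≡0⇒i≡j; i≤j⇒0≤j-i; 0≤i-j⇒j≤i; +-inverseʳ)
  open LinearAlgebra K d using (gens; Dim; Defect; LinIndep; BK; Basis; MaxBK)
  open Coordinates K using (dim-unique; dim-mono; dim-submodular)
  open Generators K n using (gens-mono; gens-∪⁻; gens-∩⁻)

  f : Subset m → ℕ
  f = proj₁ ∘ rank

  f-dim : ∀ X → Dim (gens n X) (f X)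
  f-dim = proj₂ ∘ rank

  f-mono : ∀ {X Y} → X ⊆ Y → f X ≤ f Y
  f-mono X⊆Y = dim-mono (gens-mono X⊆Y) (f-dim _) (f-dim _)

  f-submodular : ∀ X Y → f (X ∪ Y) Nat.+ f (X ∩ Y) ≤ f X Nat.+ f Y
  f-submodular X Y =
    dim-submodular (gens-∪⁻ X Y) (gens-∩⁻ X Y) (f-dim X) (f-dim Y) (f-dim (X ∪ Y)) (f-dim (X ∩ Y))

  open InducedMatroid f f-mono f-submodular public

  defect≡ : ∀ {S z} → Defect n S z → z ≡ + f S - + ∣ S ∣
  defect≡ {S} (r , r-dim , refl) = cong (λ r → + r - + ∣ S ∣) (dim-unique r-dim (f-dim S))

  linIndep⇒independent : ∀ {X} → LinIndep n X → Independent X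
  linIndep⇒independent X-linIndep S S⊆X = drop‿+≤+ (0≤i-j⇒j≤i (X-linIndep S S⊆X _ (f S , f-dim S , refl)))

  independent⇒linIndep : ∀ {X} → Independent X → LinIndep n X
  independent⇒linIndep X-ind S S⊆X z S-defect =
    subst (+ 0 ℤ≤_) (sym (defect≡ S-defect)) (i≤j⇒0≤j-i (+≤+ (X-ind S S⊆X)))

  BK⇒isBK : ∀ {X} → BK n X → IsBK X
  BK⇒isBK (X-linIndep , X-defect) =
    linIndep⇒independent X-linIndep , +-injective (i-j≡0⇒i≡j _ _ (sym (defect≡ X-defect)))

  isBK⇒BK : ∀ {X} → IsBK X → BK n X
  isBK⇒BK {X} (X-ind , X-tight) = independent⇒linIndep X-ind ,
    (f X , f-dim X , sym (trans (cong (λ r → + r - + ∣ X ∣) X-tight) (+-inverseʳ (+ ∣ X ∣))))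

  basis⇒isBasis : ∀ {b} → Basis n b → IsBasis b
  basis⇒isBasis (b-linIndep , b-max) = record
    { independent = linIndep⇒independent b-linIndep
    ; maximal     = λ X b⊆X X-ind → b-max X b⊆X (independent⇒linIndep X-ind)
    }

  maxBK⇒isMaxBKIn : ∀ {b k} → MaxBK n b k → IsMaxBKIn b k
  maxBK⇒isMaxBKIn (k⊆b , k-BK , k-max) = record
    { core⊆    = k⊆b
    ; core-BK  = BK⇒isBK k-BK
    ; core-max = λ X k⊆X X⊆b X-BK → k-max X k⊆X X⊆b (isBK⇒BK X-BK)
    }

corollary2p7 : ∀ {c ℓ} (K : Field c ℓ) (d m : ℕ) (n : LinearAlgebra.Tuple K d m) →
    LinearAlgebra.LinDep K d n →
    ∀ (b b' k k' : Subset m) →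
    LinearAlgebra.Basis K d n b → LinearAlgebra.MaxBK K d n b k →
    LinearAlgebra.Basis K d n b' → LinearAlgebra.MaxBK K d n b' k' →
    ∣ k ∣ ≡ ∣ k' ∣
corollary2p7 K d m n _ b b′ k k′ b-basis k-core b′-basis k′-core =
  decidable-stable (∣ k ∣ Nat.≟ ∣ k′ ∣) (¬¬-map card-unique (¬¬-∀-Subset (¬¬-dim ∘ gens n)))
  where
  open LinearAlgebra K d using (gens; Dim)
  open Coordinates K using (¬¬-dim)
  card-unique : (∀ X → Σ ℕ (Dim (gens n X))) → ∣ k ∣ ≡ ∣ k′ ∣
  card-unique rank = maxBK-card-unique (basis⇒isBasis b-basis) (maxBK⇒isMaxBKIn k-core)
                                       (basis⇒isBasis b′-basis) (maxBK⇒isMaxBKIn k′-core)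
    where open MinkowskiMatroid K n rank
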